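{- Let $n\ge 3$ be an integer and $F\subseteq E(K_n)$. Then: (i) $S_F$ is a total mutual-visibility set of $L(K_n)$ if and only if for any two non-incident edges $uv,u'v'\in E(K_n)$, the subgraph of $K_n$ induced by $u,v,u',v'$ has at least one edge not in $F$ different from $uv$ and $u'v'$. (ii) $S_F$ is a dual mutual-visibility set of $L(K_n)$ if and only if (a) for any two non-incident edges $uv,u'v'\in E(K_n)\setminus F$ the subgraph induced by $u,v,u',v'$ has at least one edge not in $F$ different from $uv$ and $u'v'$, and (b) for any two non-incident edges $xy,x'y'\in F$ the subgraph induced by $x,y,x',y'$ has at least one edge not in $F$ different from $xy$ and $x'y'$. (iii) $S_F$ is an outer mutual-visibility set of $L(K_n)$ if and only if (a) for any two non-incident edges $uv,u'v'$ with $uv\in E(K_n)\setminus F$ and $u'v'\in F$ the subgraph induced by $u,v,u',v'$ has at least one edge not in $F$ different from $uv$ and $u'v'$, and (b) for any two non-incident edges $xy,x'y'\in F$ the subgraph induced by $x,y,x',y'$ has at least one edge not in $F$ different from $xy$ and $x'y'$.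
   Context: $L(K_n)$ is the line graph of $K_n$, with vertex set $\{e_{uv}: uv\in E(K_n)\}$, $e_{uv}$ and $e_{u'v'}$ adjacent iff the edges share an endpoint; for $F\subseteq E(K_n)$, $S_F=\{e_{uv}:uv\in F\}$. For a connected graph $H$ and $X\subseteq V(H)$, two vertices are $X$-visible if there is a shortest path between them whose internal vertices are not in $X$. $X$ is a total mutual-visibility set if every two vertices of $H$ are $X$-visible; a dual mutual-visibility set if every two vertices of $X$ and every two vertices of $V(H)\setminus X$ are $X$-visible; an outer mutual-visibility set if every two vertices of $X$ are $X$-visible and every $x\in X$, $y\in V(H)\setminus X$ are $X$-visible. -}

module Defs where

open import Data.Nat using (ℕ; zero; suc; _≤_)
open import Data.Fin using (Fin) renaming (_<_ to _<ᶠ_)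
open import Data.Product using (Σ; _×_; ∃-syntax)
open import Data.Sum using (_⊎_)
open import Data.Unit using (⊤)
open import Relation.Nullary using (¬_)
open import Relation.Binary.PropositionalEquality using (_≡_)

record Graph : Set₁ where
  field
    V   : Set
    Adj : V → V → Set

module _ (G : Graph) where
  open Graph G

  data Path : V → V → Set where
    []  : ∀ {x} → Path x x
    _∷_ : ∀ {x y z} → Adj x y → Path y z → Path x z

  len : ∀ {x z} → Path x z → ℕ
  len []      = zero
  len (_ ∷ p) = suc (len p)

  IsShortest : ∀ {x z} → Path x z → Set
  IsShortest {x} {z} p = (q : Path x z) → len p ≤ len q

  InternalAvoid : (V → Set) → ∀ {x z} → Path x z → Set
  InternalAvoid X []                          = ⊤
  InternalAvoid X (e ∷ [])                    = ⊤
  InternalAvoid X (_∷_ {y = y} e (e' ∷ p))    = ¬ X y × InternalAvoid X (e' ∷ p)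

  Visible : (V → Set) → V → V → Set
  Visible X x z = Σ (Path x z) (λ p → IsShortest p × InternalAvoid X p)

  TotalMV : (V → Set) → Set
  TotalMV X = ∀ x y → Visible X x y

  DualMV : (V → Set) → Set
  DualMV X = (∀ x y → X x → X y → Visible X x y)
           × (∀ x y → ¬ X x → ¬ X y → Visible X x y)

  OuterMV : (V → Set) → Set
  OuterMV X = (∀ x y → X x → X y → Visible X x y)
            × (∀ x y → X x → ¬ X y → Visible X x y)

-- Edges of K_n: unordered pairs {u,v}, represented with u < v

record Edge (n : ℕ) : Set where
  constructor edge
  field
    u   : Fin n
    v   : Fin n
    u<v : u <ᶠ v
open Edge public

SameEdge : ∀ {n} → Edge n → Edge n → Set
SameEdge e f = (u e ≡ u f) × (v e ≡ v f)

Incident : ∀ {n} → Edge n → Edge n → Set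
Incident e f = (u e ≡ u f) ⊎ (u e ≡ v f) ⊎ (v e ≡ u f) ⊎ (v e ≡ v f)

LK : ℕ → Graph
LK n = record { V = Edge n ; Adj = λ e f → ¬ SameEdge e f × Incident e f }

S : ∀ {n} → (Edge n → Set) → (Edge n → Set)
S F e = F e

InFour : ∀ {n} → Fin n → Edge n → Edge n → Set
InFour w e f = (w ≡ u e) ⊎ (w ≡ v e) ⊎ (w ≡ u f) ⊎ (w ≡ v f)

GoodPair : ∀ {n} → (Edge n → Set) → Edge n → Edge n → Set
GoodPair F e f = ∃[ g ] (InFour (u g) e f × InFour (v g) e f
                        × ¬ F g × ¬ SameEdge g e × ¬ SameEdge g f)

-- Two non-incident edges x, y of K_n are at distance exactly 2 in L(K_n), and the
-- middle vertices of the shortest x–y paths are precisely the edges joining an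
-- endpoint of x to an endpoint of y.  So x and y are S_F-visible iff one of these
-- edges lies outside F, which is the condition on the induced four-vertex subgraph.
-- Equal or incident edges are always visible (distance 0 or 1, no internal
-- vertices), so each of the three kinds of mutual-visibility set is characterised
-- by the condition on those pairs of non-incident edges it has to make visible.
module Submission where

open import Defs
open import Data.Nat using (ℕ; _≤_; z≤n; s≤s)
open import Data.Fin using (Fin)
open import Data.Fin.Properties using (_≟_; <-cmp; <-irrefl; <-asym; <-irrelevant)
open import Data.Product using (_×_; _,_; ∃-syntax)
open import Data.Sum using (_⊎_; inj₁; inj₂)
open import Data.Unit using (tt)
open import Data.Empty using (⊥-elim)
open import Function.Base using (_∘_)
open import Function.Bundles using (_⇔_; mk⇔)
open import Relation.Nullary using (¬_; Dec; yes; no)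
open import Relation.Nullary.Decidable using (_⊎-dec_; _×-dec_)
open import Relation.Binary.Definitions using (tri<; tri≈; tri>)
open import Relation.Binary.PropositionalEquality using (_≡_; _≢_; refl; sym; trans; cong; subst)

private
  variable
    n : ℕ
    w : Fin n
    e f g x y : Edge n

-- A data type rather than a sum of equations, so that the edge stays inferable.
data Endpoint (w : Fin n) (e : Edge n) : Set where
  is-u : w ≡ u e → Endpoint w e
  is-v : w ≡ v e → Endpoint w e

¬sameEdge-sym : ¬ SameEdge e f → ¬ SameEdge f e
¬sameEdge-sym e≉f (p , q) = e≉f (sym p , sym q)

sameEdge⇒≡ : SameEdge e f → e ≡ f
sameEdge⇒≡ {e = edge a b p} {f = edge .a .b q} (refl , refl) = cong (edge a b) (<-irrelevant p q)

endpoints⇒sameEdge : Endpoint (u g) e → Endpoint (v g) e → SameEdge g e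
endpoints⇒sameEdge {g = edge _ _ p}                  (is-u refl) (is-u refl) = ⊥-elim (<-irrefl refl p)
endpoints⇒sameEdge                                   (is-u refl) (is-v refl) = refl , refl
endpoints⇒sameEdge {g = edge _ _ p} {e = edge _ _ q} (is-v refl) (is-u refl) = ⊥-elim (<-asym p q)
endpoints⇒sameEdge {g = edge _ _ p}                  (is-v refl) (is-v refl) = ⊥-elim (<-irrefl refl p)

shared⇒incident : Endpoint w e → Endpoint w f → Incident e f
shared⇒incident (is-u p) (is-u q) = inj₁ (trans (sym p) q)
shared⇒incident (is-u p) (is-v q) = inj₂ (inj₁ (trans (sym p) q))
shared⇒incident (is-v p) (is-u q) = inj₂ (inj₂ (inj₁ (trans (sym p) q)))
shared⇒incident (is-v p) (is-v q) = inj₂ (inj₂ (inj₂ (trans (sym p) q)))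

incident⇒shared : Incident g e → Endpoint (u g) e ⊎ Endpoint (v g) e
incident⇒shared (inj₁ p)                 = inj₁ (is-u p)
incident⇒shared (inj₂ (inj₁ p))          = inj₁ (is-v p)
incident⇒shared (inj₂ (inj₂ (inj₁ p)))   = inj₂ (is-u p)
incident⇒shared (inj₂ (inj₂ (inj₂ p)))   = inj₂ (is-v p)

incident-sym : Incident e f → Incident f e
incident-sym (inj₁ p)                = inj₁ (sym p)
incident-sym (inj₂ (inj₁ p))         = inj₂ (inj₂ (inj₁ (sym p)))
incident-sym (inj₂ (inj₂ (inj₁ p)))  = inj₂ (inj₁ (sym p))
incident-sym (inj₂ (inj₂ (inj₂ p)))  = inj₂ (inj₂ (inj₂ (sym p)))

incident? : (e f : Edge n) → Dec (Incident e f)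
incident? e f = (u e ≟ u f) ⊎-dec ((u e ≟ v f) ⊎-dec ((v e ≟ u f) ⊎-dec (v e ≟ v f)))

edge-joining : {a b : Fin n} → a ≢ b → ∃[ g ] Endpoint a g × Endpoint b g
edge-joining {a = a} {b = b} a≢b with <-cmp a b
... | tri< a<b _ _ = edge a b a<b , is-u refl , is-v refl
... | tri≈ _ a≡b _ = ⊥-elim (a≢b a≡b)
... | tri> _ _ b<a = edge b a b<a , is-v refl , is-u refl

inFour⇒endpoint : InFour w e f → Endpoint w e ⊎ Endpoint w f
inFour⇒endpoint (inj₁ p)                = inj₁ (is-u p)
inFour⇒endpoint (inj₂ (inj₁ p))         = inj₁ (is-v p)
inFour⇒endpoint (inj₂ (inj₂ (inj₁ p)))  = inj₂ (is-u p)
inFour⇒endpoint (inj₂ (inj₂ (inj₂ p)))  = inj₂ (is-v p)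

endpoint⇒inFourˡ : Endpoint w e → InFour w e f
endpoint⇒inFourˡ (is-u p) = inj₁ p
endpoint⇒inFourˡ (is-v p) = inj₂ (inj₁ p)

endpoint⇒inFourʳ : Endpoint w f → InFour w e f
endpoint⇒inFourʳ (is-u p) = inj₂ (inj₂ (inj₁ p))
endpoint⇒inFourʳ (is-v p) = inj₂ (inj₂ (inj₂ p))

inFour-swap : InFour w e f → InFour w f e
inFour-swap (inj₁ p)                = inj₂ (inj₂ (inj₁ p))
inFour-swap (inj₂ (inj₁ p))         = inj₂ (inj₂ (inj₂ p))
inFour-swap (inj₂ (inj₂ (inj₁ p)))  = inj₁ p
inFour-swap (inj₂ (inj₂ (inj₂ p)))  = inj₂ (inj₁ p)

goodPair-sym : {F : Edge n → Set} → GoodPair F e f → GoodPair F f e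
goodPair-sym {e = e} {f = f} (g , ug , vg , g∉F , g≉e , g≉f) =
  g , inFour-swap {e = e} {f = f} ug , inFour-swap {e = e} {f = f} vg , g∉F , g≉f , g≉e

goodPair-flip : {F : Edge n → Set} (e f : Edge n) →
  (¬ Incident f e → GoodPair F f e) → ¬ Incident e f → GoodPair F e f
goodPair-flip e f good e∦f =
  goodPair-sym {e = f} {f = e} (good (e∦f ∘ incident-sym {e = f} {f = e}))

module _ {n : ℕ} (F : Edge n → Set) where

  private
    L = LK n

  path-through : {a b : Fin n} (g : Edge n) → ¬ Incident x y →
    Endpoint a x → Endpoint a g → Endpoint b g → Endpoint b y → Path L x y
  path-through {x = x} {y = y} {a} {b} g x∦y ax ag bg by =
    _∷_ {y = g} (x≉g , shared⇒incident ax ag) ((g≉y , shared⇒incident bg by) ∷ [])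
    where
    x≉g : ¬ SameEdge x g
    x≉g x≈g = x∦y (shared⇒incident (subst (Endpoint b) (sym (sameEdge⇒≡ {e = x} {f = g} x≈g)) bg) by)
    g≉y : ¬ SameEdge g y
    g≉y g≈y = x∦y (shared⇒incident ax (subst (Endpoint a) (sameEdge⇒≡ {e = g} {f = y} g≈y) ag))

  non-incident⇒length≥2 : ¬ Incident x y → (p : Path L x y) → 2 ≤ len L p
  non-incident⇒length≥2 x∦y []              = ⊥-elim (x∦y (inj₁ refl))
  non-incident⇒length≥2 x∦y ((_ , x∣y) ∷ []) = ⊥-elim (x∦y x∣y)
  non-incident⇒length≥2 x∦y (_ ∷ (_ ∷ _))     = s≤s (s≤s z≤n)

  non-incident⇒path-of-length2 : ¬ Incident x y → ∃[ p ] len L {x} {y} p ≡ 2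
  non-incident⇒path-of-length2 {x = x} {y = y} x∦y
    with edge-joining {a = u x} {b = u y} (x∦y ∘ inj₁)
  ... | g , ux∈g , uy∈g = path-through g x∦y (is-u refl) ux∈g uy∈g (is-u refl) , refl

  goodPair⇒visible : ¬ Incident x y → GoodPair F x y → Visible L F x y
  goodPair⇒visible {x = x} {y = y} x∦y (g , ug∈ , vg∈ , g∉F , g≉x , g≉y)
    with inFour⇒endpoint ug∈ | inFour⇒endpoint vg∈
  ... | inj₁ ug∈x | inj₁ vg∈x = ⊥-elim (g≉x (endpoints⇒sameEdge {g = g} ug∈x vg∈x))
  ... | inj₂ ug∈y | inj₂ vg∈y = ⊥-elim (g≉y (endpoints⇒sameEdge {g = g} ug∈y vg∈y))
  ... | inj₁ ug∈x | inj₂ vg∈y =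
    path-through g x∦y ug∈x (is-u refl) (is-v refl) vg∈y , non-incident⇒length≥2 x∦y , g∉F , tt
  ... | inj₂ ug∈y | inj₁ vg∈x =
    path-through g x∦y vg∈x (is-v refl) (is-u refl) ug∈y , non-incident⇒length≥2 x∦y , g∉F , tt

  visible⇒goodPair : ¬ Incident x y → Visible L F x y → GoodPair F x y
  visible⇒goodPair x∦y ([] , _)              = ⊥-elim (x∦y (inj₁ refl))
  visible⇒goodPair x∦y (((_ , x∣y) ∷ []) , _) = ⊥-elim (x∦y x∣y)
  visible⇒goodPair x∦y ((_ ∷ (_ ∷ (_ ∷ _))) , shortest , _)
    with non-incident⇒path-of-length2 x∦y
  ... | q , len≡2 with subst (_ ≤_) len≡2 (shortest q)
  ...   | s≤s (s≤s ())
  visible⇒goodPair {x = x} {y = y} x∦y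
    ((_∷_ {y = g} (x≉g , x∣g) ((g≉y , g∣y) ∷ [])) , _ , g∉F , _)
    with incident⇒shared {g = g} {e = x} (incident-sym {e = x} {f = g} x∣g)
       | incident⇒shared {g = g} {e = y} g∣y
  ... | inj₁ ug∈x | inj₁ ug∈y = ⊥-elim (x∦y (shared⇒incident ug∈x ug∈y))
  ... | inj₂ vg∈x | inj₂ vg∈y = ⊥-elim (x∦y (shared⇒incident vg∈x vg∈y))
  ... | inj₁ ug∈x | inj₂ vg∈y =
    g , endpoint⇒inFourˡ {f = y} ug∈x , endpoint⇒inFourʳ {e = x} vg∈y , g∉F , ¬sameEdge-sym {e = x} {f = g} x≉g , g≉y
  ... | inj₂ vg∈x | inj₁ ug∈y =
    g , endpoint⇒inFourʳ {e = x} ug∈y , endpoint⇒inFourˡ {f = y} vg∈x , g∉F , ¬sameEdge-sym {e = x} {f = g} x≉g , g≉y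

  adjacent⇒visible : ¬ SameEdge x y → Incident x y → Visible L F x y
  adjacent⇒visible {x = x} {y = y} x≉y x∣y = ((x≉y , x∣y) ∷ []) , length≥1 , tt
    where
    length≥1 : (p : Path L x y) → 1 ≤ len L p
    length≥1 []      = ⊥-elim (x≉y (refl , refl))
    length≥1 (_ ∷ _) = s≤s z≤n

  visible-if-goodPair : (¬ Incident x y → GoodPair F x y) → Visible L F x y
  visible-if-goodPair {x = x} {y = y} good with (u x ≟ u y) ×-dec (v x ≟ v y)
  ... | yes x≈y = subst (Visible L F x) (sameEdge⇒≡ x≈y) ([] , (λ _ → z≤n) , tt)
  ... | no x≉y with incident? x y
  ...   | yes x∣y = adjacent⇒visible x≉y x∣y
  ...   | no x∦y  = goodPair⇒visible x∦y (good x∦y)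

lemma3p4 : (n : ℕ) → 3 ≤ n → (F : Edge n → Set) →
    (TotalMV (LK n) (S F) ⇔
      (∀ e f → ¬ Incident e f → GoodPair F e f))
    × (DualMV (LK n) (S F) ⇔
      ((∀ e f → ¬ F e → ¬ F f → ¬ Incident e f → GoodPair F e f)
       × (∀ e f → F e → F f → ¬ Incident e f → GoodPair F e f)))
    × (OuterMV (LK n) (S F) ⇔
      ((∀ e f → ¬ F e → F f → ¬ Incident e f → GoodPair F e f)
       × (∀ e f → F e → F f → ¬ Incident e f → GoodPair F e f)))
lemma3p4 n _ F =
  mk⇔ (λ total e f e∦f → visible⇒goodPair F e∦f (total e f))
      (λ good e f → visible-if-goodPair F (good e f)) ,
  mk⇔ (λ (inside , outside) →
         (λ e f e∉ f∉ e∦f → visible⇒goodPair F e∦f (outside e f e∉ f∉)) ,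
         (λ e f e∈ f∈ e∦f → visible⇒goodPair F e∦f (inside e f e∈ f∈)))
      (λ (outside , inside) →
         (λ e f e∈ f∈ → visible-if-goodPair F (inside e f e∈ f∈)) ,
         (λ e f e∉ f∉ → visible-if-goodPair F (outside e f e∉ f∉))) ,
  mk⇔ (λ (inside , across) →
         (λ e f e∉ f∈ → goodPair-flip e f λ f∦e → visible⇒goodPair F f∦e (across f e f∈ e∉)) ,
         (λ e f e∈ f∈ e∦f → visible⇒goodPair F e∦f (inside e f e∈ f∈)))
      (λ (across , inside) →
         (λ e f e∈ f∈ → visible-if-goodPair F (inside e f e∈ f∈)) ,
         (λ e f e∈ f∉ → visible-if-goodPair F (goodPair-flip e f (across f e f∉ e∈))))
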